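{- Let $G$ be a graph, $v\in V(G)$, and let $G+\{x\}$ be obtained from $G$ by adding a new vertex $x$ adjacent only to $v$. Then $\alpha(G)=\alpha(G+\{x\})$.
   Context: All graphs are finite, simple, undirected, unweighted and connected. $D_G(v,r)=\{u: d_G(u,v)\le r\}$. A graph $G$ is $\alpha$-weakly-Helly if for every family of pairwise intersecting disks $\{D_G(v,r(v)) : v\in S\}$ the disks $D_G(v,r(v)+\alpha)$, $v\in S$, have a common vertex. The Helly-gap $\alpha(G)$ is the minimum $\alpha\ge0$ for which $G$ is $\alpha$-weakly-Helly. -}

module Defs where

open import Data.Nat using (ℕ; zero; suc; _+_; _≤_)
open import Data.Fin using (Fin; zero; suc)
open import Data.Fin.Subset using (Subset; _∈_)
open import Data.Product using (Σ; ∃; ∃-syntax; _×_; _,_)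
open import Data.Empty using (⊥)
open import Relation.Nullary using (¬_)
open import Relation.Binary.PropositionalEquality using (_≡_)
open import Function.Bundles using (_⇔_)

record Graph (n : ℕ) : Set₁ where
  field
    Adj   : Fin n → Fin n → Set
    sym   : ∀ {u v} → Adj u v → Adj v u
    irrefl : ∀ {u} → ¬ Adj u u

open Graph public

data Walk {n : ℕ} (G : Graph n) : Fin n → Fin n → ℕ → Set where
  here : ∀ {u} → Walk G u u 0
  step : ∀ {u w v k} → Adj G u w → Walk G w v k → Walk G u v (suc k)

Dist≤ : ∀ {n} → Graph n → Fin n → Fin n → ℕ → Set
Dist≤ G u v r = Σ ℕ λ k → k ≤ r × Walk G u v k

Connected : ∀ {n} → Graph n → Set
Connected G = ∀ u v → Σ ℕ λ k → Walk G u v k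

InDisk : ∀ {n} → Graph n → Fin n → Fin n → ℕ → Set
InDisk G u v r = Dist≤ G u v r

WeaklyHelly : ∀ {n} → Graph n → ℕ → Set
WeaklyHelly {n} G α =
  (S : Subset n) (r : Fin n → ℕ) →
  (∀ u v → u ∈ S → v ∈ S → ∃[ w ] (InDisk G w u (r u) × InDisk G w v (r v))) →
  ∃[ w ] (∀ u → u ∈ S → InDisk G w u (r u + α))

IsHellyGap : ∀ {n} → Graph n → ℕ → Set
IsHellyGap G α = WeaklyHelly G α × (∀ β → WeaklyHelly G β → α ≤ β)

-- G + {x}: new vertex x = zero, old vertex i becomes suc i; x adjacent only to v.
pendAdj : ∀ {n} → Graph n → Fin n → Fin (suc n) → Fin (suc n) → Set
pendAdj G v zero    zero    = ⊥
pendAdj G v zero    (suc j) = j ≡ v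
pendAdj G v (suc i) zero    = i ≡ v
pendAdj G v (suc i) (suc j) = Adj G i j

addPendant : ∀ {n} → Graph n → Fin n → Graph (suc n)
addPendant {n} G v = record { Adj = pendAdj G v ; sym = λ {a} {b} → s {a} {b} ; irrefl = λ {a} → ir {a} }
  where
  s : ∀ {a b} → pendAdj G v a b → pendAdj G v b a
  s {zero} {zero} ()
  s {zero} {suc j} p = p
  s {suc i} {zero} p = p
  s {suc i} {suc j} p = sym G p
  ir : ∀ {a} → ¬ pendAdj G v a a
  ir {zero} ()
  ir {suc i} p = irrefl G p

module Submission where

-- It suffices to show that for every β, G is β-weakly-Helly iff G⁺ = G + {x}
-- is (`weaklyHelly-pendant`); the Helly-gaps then agree (`IsHellyGap-cong`).
-- The two graphs are compared through the inclusion i ↦ suc i of G into G⁺,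
-- which preserves distances, and the retraction `collapse` of G⁺ onto G
-- sending x to v, which does not increase them.  Moreover a walk of length
-- s+1 into x yields a walk of length s into v, and conversely.
--
-- From G⁺ to G: a family of disks in G is lifted into G⁺, a common point of
-- the enlarged disks there is collapsed back into G.
-- From G to G⁺: a pairwise intersecting family of disks in G⁺ is replaced by
-- a family in G whose disks contain the collapses of the G⁺-disks and whose
-- β-enlargements lift into the enlarged G⁺-disks (`transfer`).  The disk
-- D(x, s+1) is dropped if some D(v, t) with t ≤ s is already present, and is
-- replaced by D(v, s) otherwise; if D(x, 0) is present, x is a common point.

open import Defs
open import Data.Nat using (ℕ; zero; suc; _+_; _≤_; z≤n; s≤s; pred)
open import Data.Nat.Properties using (≤-refl; ≤-trans; ≤-total; n≤1+n; m≤m+n; +-monoˡ-≤; pred-mono-≤)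
open import Data.Fin using (Fin; zero; suc; _≟_)
open import Data.Fin.Subset using (_∈_)
open import Data.Bool using (Bool; true; false)
open import Data.Vec using (tabulate; lookup)
open import Data.Vec.Properties using (lookup∘tabulate; []=⇒lookup; lookup⇒[]=)
open import Data.Vec.Functional using (tail; updateAt; _∷_)
open import Data.Vec.Functional.Properties using (updateAt-updates; updateAt-minimal)
open import Data.Product using (∃-syntax; _×_; _,_)
open import Data.Sum using (inj₁; inj₂)
open import Function using (const)
open import Function.Bundles using (_⇔_; mk⇔; Equivalence)
open import Relation.Nullary using (yes; no; contradiction)
open import Relation.Binary.PropositionalEquality using (_≡_; _≢_; refl; trans; subst; subst₂) renaming (sym to ≡-sym)

private
  variable
    n : ℕ

Dist≤-weaken : ∀ {H : Graph n} {a b k k′} → k ≤ k′ → Dist≤ H a b k → Dist≤ H a b k′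
Dist≤-weaken k≤k′ (m , m≤k , walk) = m , ≤-trans m≤k k≤k′ , walk

Walk-snoc : ∀ {H : Graph n} {a b c k} → Walk H a b k → Adj H b c → Walk H a c (suc k)
Walk-snoc here        e = step e here
Walk-snoc (step e′ w) e = step e′ (Walk-snoc w e)

Dist≤-zero : ∀ {H : Graph n} {a b} → Dist≤ H a b 0 → a ≡ b
Dist≤-zero (zero , z≤n , here) = refl

PairwiseMeet : Graph n → (Fin n → Bool) → (Fin n → ℕ) → Set
PairwiseMeet G S r = ∀ u w → S u ≡ true → S w ≡ true →
  ∃[ x ] (Dist≤ G x u (r u) × Dist≤ G x w (r w))

CommonPoint : Graph n → (Fin n → Bool) → (Fin n → ℕ) → ℕ → Set
CommonPoint G S r β = ∃[ x ] (∀ u → S u ≡ true → Dist≤ G x u (r u + β))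

WeaklyHelly′ : Graph n → ℕ → Set
WeaklyHelly′ G β = ∀ S r → PairwiseMeet G S r → CommonPoint G S r β

WeaklyHelly⇔ : (G : Graph n) (β : ℕ) → WeaklyHelly G β ⇔ WeaklyHelly′ G β
WeaklyHelly⇔ G β = mk⇔ toFunctions toSubsets
  where
  toFunctions : WeaklyHelly G β → WeaklyHelly′ G β
  toFunctions helly S r meet
    with helly (tabulate S) r (λ u w u∈ w∈ → meet u w (member u u∈) (member w w∈))
    where
    member : ∀ u → u ∈ tabulate S → S u ≡ true
    member u u∈ = trans (≡-sym (lookup∘tabulate S u)) ([]=⇒lookup u∈)
  ... | x , near = x , λ u Su → near u (lookup⇒[]= u (tabulate S) (trans (lookup∘tabulate S u) Su))

  toSubsets : WeaklyHelly′ G β → WeaklyHelly G β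
  toSubsets helly S r meet
    with helly (lookup S) r (λ u w u∈ w∈ → meet u w (lookup⇒[]= u S u∈) (lookup⇒[]= w S w∈))
  ... | x , near = x , λ u u∈ → near u ([]=⇒lookup u∈)

IsHellyGap-cong : ∀ {m} {G : Graph n} {H : Graph m} →
  (∀ β → WeaklyHelly G β ⇔ WeaklyHelly H β) → ∀ α → IsHellyGap G α ⇔ IsHellyGap H α
IsHellyGap-cong same α = mk⇔
  (λ (helly , least) → to (same α) helly , λ β h → least β (from (same β) h))
  (λ (helly , least) → from (same α) helly , λ β h → least β (to (same β) h))
  where open Equivalence

module Pendant (G : Graph n) (v : Fin n) where

  G⁺ : Graph (suc n)
  G⁺ = addPendant G v

  collapse : Fin (suc n) → Fin n
  collapse zero    = v
  collapse (suc i) = i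

  liftWalk : ∀ {a b k} → Walk G a b k → Walk G⁺ (suc a) (suc b) k
  liftWalk here       = here
  liftWalk (step e w) = step e (liftWalk w)

  -- `collapse` is non-expansive: edges at x become loops at v and are skipped.
  collapseWalk : ∀ {a b k} → Walk G⁺ a b k → Dist≤ G (collapse a) (collapse b) k
  collapseWalk here = 0 , z≤n , here
  collapseWalk (step {zero}  {zero}  () _)
  collapseWalk (step {zero}  {suc j} refl w) = Dist≤-weaken (n≤1+n _) (collapseWalk w)
  collapseWalk (step {suc i} {zero}  refl w) = Dist≤-weaken (n≤1+n _) (collapseWalk w)
  collapseWalk (step {suc i} {suc j} e w) with collapseWalk w
  ... | m , m≤k , w′ = suc m , s≤s m≤k , step e w′

  walkToPendant : ∀ {a k} → Walk G⁺ a zero k → Dist≤ G (collapse a) v (pred k)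
  walkToPendant here = 0 , z≤n , here
  walkToPendant (step {zero}  {zero}  () _)
  walkToPendant (step {zero}  {suc j} refl _) = 0 , z≤n , here
  walkToPendant (step {suc i} {zero}  refl _) = 0 , z≤n , here
  walkToPendant (step {suc i} {suc j} {k = zero}  e ())
  walkToPendant (step {suc i} {suc j} {k = suc k} e w) with walkToPendant w
  ... | m , m≤k , w′ = suc m , s≤s m≤k , step e w′

  CollapsesInto : Fin (suc n) → ℕ → Fin n → ℕ → Set
  CollapsesInto a ρ i r = ∀ w → Dist≤ G⁺ w a ρ → Dist≤ G (collapse w) i r

  LiftsInto : Fin n → ℕ → Fin (suc n) → ℕ → Set
  LiftsInto i r a ρ = ∀ w → Dist≤ G w i r → Dist≤ G⁺ (suc w) a ρ

  old-collapses : ∀ i ρ → CollapsesInto (suc i) ρ i ρ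
  old-collapses i ρ w (m , m≤ρ , walk) = Dist≤-weaken m≤ρ (collapseWalk walk)

  pendant-collapses : ∀ s → CollapsesInto zero (suc s) v s
  pendant-collapses s w (m , m≤ , walk) = Dist≤-weaken (pred-mono-≤ m≤) (walkToPendant walk)

  old-lifts : ∀ i ρ → LiftsInto i ρ (suc i) ρ
  old-lifts i ρ w (m , m≤ρ , walk) = m , m≤ρ , liftWalk walk

  lifts-to-pendant : ∀ {t s} β → t ≤ s → LiftsInto v (t + β) zero (suc s + β)
  lifts-to-pendant β t≤s w (m , m≤ , walk) =
    suc m , s≤s (≤-trans m≤ (+-monoˡ-≤ β t≤s)) , Walk-snoc (liftWalk walk) refl

  module _ (β : ℕ) (helly : WeaklyHelly′ G β) (S⁺ : Fin (suc n) → Bool) (r⁺ : Fin (suc n) → ℕ)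
           (meet⁺ : PairwiseMeet G⁺ S⁺ r⁺) where

    transfer : (S : Fin n → Bool) (r : Fin n → ℕ) →
      (∀ i → S i ≡ true → ∃[ a ] (S⁺ a ≡ true × CollapsesInto a (r⁺ a) i (r i))) →
      (∀ a → S⁺ a ≡ true → ∃[ i ] (S i ≡ true × LiftsInto i (r i + β) a (r⁺ a + β))) →
      CommonPoint G⁺ S⁺ r⁺ β
    transfer S r source target with helly S r meet
      where
      meet : PairwiseMeet G S r
      meet i j Si Sj with source i Si | source j Sj
      ... | a , S⁺a , into-i | b , S⁺b , into-j with meet⁺ a b S⁺a S⁺b
      ... | y , y∈a , y∈b = collapse y , into-i y y∈a , into-j y y∈b
    ... | x , near = suc x , λ a S⁺a → lift-near (target a S⁺a)
      where
      lift-near : ∀ {a} → ∃[ i ] (S i ≡ true × LiftsInto i (r i + β) a (r⁺ a + β)) →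
                  Dist≤ G⁺ (suc x) a (r⁺ a + β)
      lift-near (i , Si , lifts) = lifts x (near i Si)

    drop-pendant : (S⁺ zero ≡ true → ∃[ s ] (r⁺ zero ≡ suc s × S⁺ (suc v) ≡ true × r⁺ (suc v) ≤ s)) →
      CommonPoint G⁺ S⁺ r⁺ β
    drop-pendant pendant = transfer (tail S⁺) (tail r⁺) source target
      where
      source : ∀ i → S⁺ (suc i) ≡ true → ∃[ a ] (S⁺ a ≡ true × CollapsesInto a (r⁺ a) i (r⁺ (suc i)))
      source i S⁺i = suc i , S⁺i , old-collapses i (r⁺ (suc i))
      target : ∀ a → S⁺ a ≡ true → ∃[ i ] (S⁺ (suc i) ≡ true × LiftsInto i (r⁺ (suc i) + β) a (r⁺ a + β))
      target zero S⁺x with pendant S⁺x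
      ... | s , r⁺x≡ , S⁺v , v-smaller = v , S⁺v ,
        subst (λ ρ → LiftsInto v (r⁺ (suc v) + β) zero (ρ + β)) (≡-sym r⁺x≡)
              (lifts-to-pendant β v-smaller)
      target (suc i) S⁺i = i , S⁺i , old-lifts i (r⁺ (suc i) + β)

    replace-pendant : ∀ s → S⁺ zero ≡ true → r⁺ zero ≡ suc s → (S⁺ (suc v) ≡ true → s ≤ r⁺ (suc v)) →
      CommonPoint G⁺ S⁺ r⁺ β
    replace-pendant s S⁺x r⁺x≡ v-larger = transfer S r source target
      where
      S : Fin n → Bool
      S = updateAt (tail S⁺) v (const true)
      r : Fin n → ℕ
      r = updateAt (tail r⁺) v (const s)
      Sv : S v ≡ true
      Sv = updateAt-updates v (tail S⁺)
      rv : r v ≡ s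
      rv = updateAt-updates v (tail r⁺)
      S-elsewhere : ∀ {i} → i ≢ v → S i ≡ S⁺ (suc i)
      S-elsewhere i≢v = updateAt-minimal _ v (tail S⁺) i≢v
      r-elsewhere : ∀ {i} → i ≢ v → r i ≡ r⁺ (suc i)
      r-elsewhere i≢v = updateAt-minimal _ v (tail r⁺) i≢v

      source : ∀ i → S i ≡ true → ∃[ a ] (S⁺ a ≡ true × CollapsesInto a (r⁺ a) i (r i))
      source i Si with i ≟ v
      ... | yes refl = zero , S⁺x ,
        subst₂ (λ ρ t → CollapsesInto zero ρ v t) (≡-sym r⁺x≡) (≡-sym rv) (pendant-collapses s)
      ... | no i≢v = suc i , trans (≡-sym (S-elsewhere i≢v)) Si ,
        subst (CollapsesInto (suc i) (r⁺ (suc i)) i) (≡-sym (r-elsewhere i≢v))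
              (old-collapses i (r⁺ (suc i)))

      target : ∀ a → S⁺ a ≡ true → ∃[ i ] (S i ≡ true × LiftsInto i (r i + β) a (r⁺ a + β))
      target zero _ = v , Sv ,
        subst₂ (λ t ρ → LiftsInto v (t + β) zero (ρ + β)) (≡-sym rv) (≡-sym r⁺x≡)
               (lifts-to-pendant β ≤-refl)
      target (suc i) S⁺i with i ≟ v
      ... | yes refl = v , Sv , λ w w-near →
        old-lifts v (r⁺ (suc v) + β) w (Dist≤-weaken (+-monoˡ-≤ β rv≤) w-near)
        where
        rv≤ : r v ≤ r⁺ (suc v)
        rv≤ = subst (_≤ r⁺ (suc v)) (≡-sym rv) (v-larger S⁺i)
      ... | no i≢v = i , trans (S-elsewhere i≢v) S⁺i ,
        subst (λ t → LiftsInto i (t + β) (suc i) (r⁺ (suc i) + β)) (≡-sym (r-elsewhere i≢v))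
              (old-lifts i (r⁺ (suc i) + β))

    pendant-centre : S⁺ zero ≡ true → r⁺ zero ≡ 0 → CommonPoint G⁺ S⁺ r⁺ β
    pendant-centre S⁺x r⁺x≡0 = zero , near
      where
      near : ∀ a → S⁺ a ≡ true → Dist≤ G⁺ zero a (r⁺ a + β)
      near a S⁺a with meet⁺ zero a S⁺x S⁺a
      ... | y , y∈x , y∈a with Dist≤-zero (subst (Dist≤ G⁺ y zero) r⁺x≡0 y∈x)
      ... | refl = Dist≤-weaken (m≤m+n _ β) y∈a

    helly⁺ : CommonPoint G⁺ S⁺ r⁺ β
    helly⁺ with S⁺ zero in S⁺x
    ... | false = drop-pendant (λ S⁺x′ → contradiction (trans (≡-sym S⁺x) S⁺x′) λ ())
    ... | true with r⁺ zero in r⁺x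
    ...   | zero  = pendant-centre S⁺x r⁺x
    ...   | suc s with S⁺ (suc v) in S⁺v | ≤-total (r⁺ (suc v)) s
    ...     | true  | inj₁ v-smaller = drop-pendant (λ _ → s , r⁺x , S⁺v , v-smaller)
    ...     | true  | inj₂ v-larger  = replace-pendant s S⁺x r⁺x (λ _ → v-larger)
    ...     | false | _ = replace-pendant s S⁺x r⁺x (λ S⁺v′ → contradiction (trans (≡-sym S⁺v) S⁺v′) λ ())

  helly⁻ : ∀ β → WeaklyHelly′ G⁺ β → WeaklyHelly′ G β
  helly⁻ β helly S r meet with helly (false ∷ S) (0 ∷ r) meet⁺
    where
    meet⁺ : PairwiseMeet G⁺ (false ∷ S) (0 ∷ r)
    meet⁺ (suc i) (suc j) Si Sj with meet i j Si Sj
    ... | y , y∈i , y∈j = suc y , old-lifts i (r i) y y∈i , old-lifts j (r j) y y∈j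
  ... | x , near = collapse x , λ i Si → old-collapses i (r i + β) x (near (suc i) Si)

  weaklyHelly-pendant : ∀ β → WeaklyHelly G β ⇔ WeaklyHelly G⁺ β
  weaklyHelly-pendant β = mk⇔
    (λ h → from (WeaklyHelly⇔ G⁺ β) (λ S⁺ r⁺ meet⁺ → helly⁺ β (to (WeaklyHelly⇔ G β) h) S⁺ r⁺ meet⁺))
    (λ h → from (WeaklyHelly⇔ G β) (helly⁻ β (to (WeaklyHelly⇔ G⁺ β) h)))
    where open Equivalence

corollary2 : ∀ {n} (G : Graph n) → Connected G → (v : Fin n) →
    ∀ (α : ℕ) → IsHellyGap G α ⇔ IsHellyGap (addPendant G v) α
corollary2 G _ v = IsHellyGap-cong (Pendant.weaklyHelly-pendant G v)
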